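{- For every integer $k\geq 3$, the minimum number $N(k)$ of vertices in a pseudo $k$-regular graph satisfies $$N(k)\leq\begin{cases}k+4 & \text{if } k \text{ is odd},\\ k+6 & \text{if } k \text{ is even}.\end{cases}$$
   Context: All graphs are finite, simple and without isolated vertices. For a vertex $i$, $d_i$ is its degree and $m_i=d_i^{ -1}\sum_{j:\, ji\in E(G)} d_j$ is its average $2$-degree. A graph is $k$-harmonic if $m_i=k$ for all vertices $i$; it is pseudo $k$-regular if it is $k$-harmonic but not $k$-regular. $N(k)$ denotes the minimum number of vertices of a pseudo $k$-regular graph. -}

module Defs where

open import Data.Nat using (ℕ; NonZero)
open import Data.Bool using (Bool; true; false; if_then_else_)
open import Data.Fin using (Fin)
open import Data.List using (map; allFin)
open import Data.Nat.ListAction using (sum)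
open import Data.Integer using (+_)
open import Data.Rational using (ℚ; _/_)
open import Data.Product using (Σ; _×_)
open import Relation.Binary.PropositionalEquality using (_≡_)
open import Relation.Nullary using (¬_)

record Graph (n : ℕ) : Set where
  field
    adj     : Fin n → Fin n → Bool
    sym     : ∀ i j → adj i j ≡ adj j i
    irrefl  : ∀ i → adj i i ≡ false
open Graph public

degree : ∀ {n} → Graph n → Fin n → ℕ
degree {n} G i = sum (map (λ j → if adj G i j then 1 else 0) (allFin n))

neighbourDegreeSum : ∀ {n} → Graph n → Fin n → ℕ
neighbourDegreeSum {n} G i =
  sum (map (λ j → if adj G i j then degree G j else 0) (allFin n))

NoIsolated : ∀ {n} → Graph n → Set
NoIsolated {n} G = ∀ (i : Fin n) → NonZero (degree G i)

avg2deg : ∀ {n} (G : Graph n) (i : Fin n) → .{{NonZero (degree G i)}} → ℚ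
avg2deg G i = (+ neighbourDegreeSum G i) / degree G i

Harmonic : ∀ {n} → Graph n → ℕ → Set
Harmonic {n} G k =
  Σ (NoIsolated G) λ nz → ∀ (i : Fin n) → avg2deg G i {{nz i}} ≡ (+ k) / 1

Regular : ∀ {n} → Graph n → ℕ → Set
Regular {n} G k = ∀ (i : Fin n) → degree G i ≡ k

PseudoRegular : ∀ {n} → Graph n → ℕ → Set
PseudoRegular G k = Harmonic G k × ¬ Regular G k

module Submission where

-- The pseudo-regular graphs are complements of sparse "balanced" graphs.  Call
-- a graph H on n vertices (c, C)-balanced when every vertex i satisfies
--   Σ_{j ~ i} h_j + h_i = c·h_i + C      (h = degree in H),
-- the degree sum is Σ h = C + c·(n - 1), every degree is at most n - 2 and some
-- degree differs from c.  Counting over the three classes "neighbour in Hᶜ",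
-- "neighbour in H", "i itself" shows that the complement Hᶜ is then
-- (n - 1 - c)-harmonic but not regular.  Balancedness is preserved by adding a
-- disjoint "block" (same local condition, degree sum c·size), so from a few
-- balanced seeds and one block we obtain (3,4)-balanced graphs on every odd
-- n ≥ 7 and (4,6)-balanced graphs on every odd n ≥ 9; their complements give
-- N(k) ≤ k + 4 for odd k and N(k) ≤ k + 5 for even k.

open import Defs hiding (sym)
open import Data.Bool using (Bool; true; false; if_then_else_; not; _∧_)
import Data.Bool.Properties as Bool
open import Data.Fin using (Fin; zero; suc; toℕ; splitAt; join; _↑ˡ_; _↑ʳ_; #_)
open import Data.Fin.Properties using (all?; splitAt-↑ˡ; splitAt-↑ʳ; join-splitAt)
  renaming (_≟_ to _≟ᶠ_)
open import Data.Integer using () renaming (+_ to ⁺_)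
import Data.Integer.Properties as ℤ
open import Data.List using (List; []; _∷_; map; allFin)
open import Data.Bool.ListAction using (any)
open import Data.List.Properties using (map-tabulate; map-cong)
open import Data.Nat using (ℕ; zero; suc; _+_; _*_; _≤_; _<_; _%_; _/_; _≡ᵇ_; NonZero; ≢-nonZero; s≤s)
import Data.Nat as ℕ
open import Data.Nat.DivMod using (m≡m%n+[m/n]*n)
open import Data.Nat.ListAction using (sum)
open import Data.Nat.Properties
open import Data.Nat.Tactic.RingSolver using (solve-∀)
open import Data.Product using (Σ; _×_; _,_)
open import Data.Rational using () renaming (_/_ to _÷_)
open import Data.Rational.Properties using (fromℚᵘ-cong)
open import Data.Rational.Unnormalised using (mkℚᵘ; *≡*)
open import Data.Sum using (_⊎_; inj₁; inj₂)
open import Data.Vec using (Vec; lookup; []; _∷_)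
open import Function using (_∘_; mk⇔)
open import Relation.Nullary using (¬_; yes; no; does; contradiction)
open import Relation.Nullary.Decidable using (True; False; toWitness; toWitnessFalse; dec-true; does-⇔)
open import Relation.Binary.PropositionalEquality

-- Finite sums over Fin n, in the list form used by Defs for degrees.

∑ : ∀ {n} → (Fin n → ℕ) → ℕ
∑ {n} f = sum (map f (allFin n))

-- The defining recursion of ∑ (it holds only up to map/tabulate fusion).
∑-suc : ∀ {n} (f : Fin (suc n) → ℕ) → ∑ f ≡ f zero + ∑ (f ∘ suc)
∑-suc f = cong (λ xs → f zero + sum xs)
  (trans (map-tabulate suc f) (sym (map-tabulate (λ x → x) (f ∘ suc))))

∑-cong : ∀ {n} {f g : Fin n → ℕ} → (∀ j → f j ≡ g j) → ∑ f ≡ ∑ g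
∑-cong {n} f≗g = cong sum (map-cong f≗g (allFin n))

∑-const : ∀ {n} (x : ℕ) → ∑ {n} (λ _ → x) ≡ n * x
∑-const {zero}  x = refl
∑-const {suc n} x = trans (∑-suc {n} (λ _ → x)) (cong (x +_) (∑-const {n} x))

∑-zero : ∀ {n} → ∑ {n} (λ _ → 0) ≡ 0
∑-zero {n} = trans (∑-const {n} 0) (*-zeroʳ n)

∑-+ : ∀ {n} (f g : Fin n → ℕ) → ∑ (λ j → f j + g j) ≡ ∑ f + ∑ g
∑-+ {zero}  f g = refl
∑-+ {suc n} f g = begin
  ∑ (λ j → f j + g j)                              ≡⟨ ∑-suc (λ j → f j + g j) ⟩
  (f zero + g zero) + ∑ (λ j → f (suc j) + g (suc j)) ≡⟨ cong (f zero + g zero +_) (∑-+ (f ∘ suc) (g ∘ suc)) ⟩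
  (f zero + g zero) + (∑ (f ∘ suc) + ∑ (g ∘ suc))   ≡⟨ +-interchange (f zero) (g zero) _ _ ⟩
  (f zero + ∑ (f ∘ suc)) + (g zero + ∑ (g ∘ suc))   ≡⟨ sym (cong₂ _+_ (∑-suc f) (∑-suc g)) ⟩
  ∑ f + ∑ g                                         ∎
  where
  open ≡-Reasoning
  +-interchange : ∀ a b x y → (a + b) + (x + y) ≡ (a + x) + (b + y)
  +-interchange = solve-∀

∑-+₃ : ∀ {n} (f g h : Fin n → ℕ) → ∑ (λ j → f j + g j + h j) ≡ ∑ f + ∑ g + ∑ h
∑-+₃ f g h = trans (∑-+ (λ j → f j + g j) h) (cong (_+ ∑ h) (∑-+ f g))

∑-*ˡ : ∀ {n} (a : ℕ) (f : Fin n → ℕ) → ∑ (λ j → a * f j) ≡ a * ∑ f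
∑-*ˡ {zero}  a f = sym (*-zeroʳ a)
∑-*ˡ {suc n} a f = begin
  ∑ (λ j → a * f j)                  ≡⟨ ∑-suc (λ j → a * f j) ⟩
  a * f zero + ∑ (λ j → a * f (suc j)) ≡⟨ cong (a * f zero +_) (∑-*ˡ a (f ∘ suc)) ⟩
  a * f zero + a * ∑ (f ∘ suc)        ≡⟨ sym (*-distribˡ-+ a (f zero) _) ⟩
  a * (f zero + ∑ (f ∘ suc))          ≡⟨ cong (a *_) (sym (∑-suc f)) ⟩
  a * ∑ f                             ∎
  where open ≡-Reasoning

∑-δ : ∀ {n} (i : Fin n) (f : Fin n → ℕ) → ∑ (λ j → if does (i ≟ᶠ j) then f j else 0) ≡ f i
∑-δ {suc n} zero    f = begin
  ∑ (λ j → if does (zero ≟ᶠ j) then f j else 0) ≡⟨ ∑-suc (λ j → if does (zero ≟ᶠ j) then f j else 0) ⟩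
  f zero + ∑ {n} (λ _ → 0)                      ≡⟨ cong (f zero +_) (∑-zero {n}) ⟩
  f zero + 0                                    ≡⟨ +-identityʳ (f zero) ⟩
  f zero                                        ∎
  where open ≡-Reasoning
∑-δ {suc n} (suc i) f =
  trans (∑-suc (λ j → if does (suc i ≟ᶠ j) then f j else 0)) (∑-δ i (f ∘ suc))

∑-split : ∀ a {b} (f : Fin (a + b) → ℕ) → ∑ f ≡ ∑ (λ x → f (x ↑ˡ b)) + ∑ (λ y → f (a ↑ʳ y))
∑-split zero    f = refl
∑-split (suc a) {b} f = begin
  ∑ f                                                            ≡⟨ ∑-suc f ⟩
  f zero + ∑ (f ∘ suc)                                           ≡⟨ cong (f zero +_) (∑-split a (f ∘ suc)) ⟩
  f zero + (∑ (λ x → f (suc (x ↑ˡ b))) + ∑ (λ y → f (suc a ↑ʳ y))) ≡⟨ sym (+-assoc (f zero) _ _) ⟩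
  f zero + ∑ (λ x → f (suc (x ↑ˡ b))) + ∑ (λ y → f (suc a ↑ʳ y))   ≡⟨ cong (_+ ∑ (λ y → f (suc a ↑ʳ y))) (sym (∑-suc (λ x → f (x ↑ˡ b)))) ⟩
  ∑ (λ x → f (x ↑ˡ b)) + ∑ (λ y → f (suc a ↑ʳ y))                  ∎
  where open ≡-Reasoning

-- Neighbourhood sums.  nbrSum G i f = Σ_{j ~ i} f j; in particular
-- degree G i = nbrSum G i (λ _ → 1) and
-- neighbourDegreeSum G i = nbrSum G i (degree G) hold definitionally.

nbrSum : ∀ {n} → Graph n → Fin n → (Fin n → ℕ) → ℕ
nbrSum G i f = ∑ (λ j → if adj G i j then f j else 0)

nbrSum-cong : ∀ {n} (G : Graph n) i {f g : Fin n → ℕ} → (∀ j → f j ≡ g j) → nbrSum G i f ≡ nbrSum G i g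
nbrSum-cong G i f≗g = ∑-cong (λ j → cong (if adj G i j then_else 0) (f≗g j))

nbrSum-+ : ∀ {n} (G : Graph n) i (f g : Fin n → ℕ) → nbrSum G i (λ j → f j + g j) ≡ nbrSum G i f + nbrSum G i g
nbrSum-+ G i f g = trans (∑-cong (λ j → split (adj G i j) (f j) (g j))) (∑-+ (λ j → if adj G i j then f j else 0) (λ j → if adj G i j then g j else 0))
  where
  split : ∀ b x y → (if b then x + y else 0) ≡ (if b then x else 0) + (if b then y else 0)
  split true  x y = refl
  split false x y = refl

nbrSum-const : ∀ {n} (G : Graph n) i (x : ℕ) → nbrSum G i (λ _ → x) ≡ x * degree G i
nbrSum-const G i x = trans (∑-cong (λ j → scale (adj G i j))) (∑-*ˡ x (λ j → if adj G i j then 1 else 0))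
  where
  scale : ∀ b → (if b then x else 0) ≡ x * (if b then 1 else 0)
  scale true  = sym (*-identityʳ x)
  scale false = sym (*-zeroʳ x)

complement : ∀ {n} → Graph n → Graph n
complement H = record
  { adj    = λ i j → not (does (i ≟ᶠ j)) ∧ not (adj H i j)
  ; sym    = λ i j → cong₂ (λ a b → not a ∧ not b)
                           (does-⇔ (mk⇔ sym sym) (i ≟ᶠ j) (j ≟ᶠ i)) (Graph.sym H i j)
  ; irrefl = λ i → cong (λ a → not a ∧ not (adj H i i)) (dec-true (i ≟ᶠ i) refl)
  }

module _ {n} (H : Graph n) where

  private
    Hᶜ = complement H

  trichotomy : ∀ i j (x : ℕ) →
    (if adj Hᶜ i j then x else 0) + (if adj H i j then x else 0) + (if does (i ≟ᶠ j) then x else 0) ≡ x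
  trichotomy i j x with i ≟ᶠ j
  ... | yes refl rewrite irrefl H i = refl
  ... | no _ with adj H i j
  ...   | true  = +-identityʳ x
  ...   | false = trans (+-identityʳ (x + 0)) (+-identityʳ x)

  complement-partition : ∀ i (f : Fin n → ℕ) → nbrSum Hᶜ i f + nbrSum H i f + f i ≡ ∑ f
  complement-partition i f = begin
    nbrSum Hᶜ i f + nbrSum H i f + f i
      ≡⟨ cong (nbrSum Hᶜ i f + nbrSum H i f +_) (sym (∑-δ i f)) ⟩
    nbrSum Hᶜ i f + nbrSum H i f + ∑ (λ j → if does (i ≟ᶠ j) then f j else 0)
      ≡⟨ sym (∑-+₃ {n} _ _ _) ⟩
    ∑ (λ j → (if adj Hᶜ i j then f j else 0) + (if adj H i j then f j else 0) + (if does (i ≟ᶠ j) then f j else 0))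
      ≡⟨ ∑-cong (λ j → trichotomy i j (f j)) ⟩
    ∑ f ∎
    where open ≡-Reasoning

  complement-degree : ∀ i → degree Hᶜ i + degree H i + 1 ≡ n
  complement-degree i = trans (complement-partition i (λ _ → 1)) (trans (∑-const {n} 1) (*-identityʳ n))

  H-neighbour-degrees : ∀ i → nbrSum H i (degree Hᶜ) + neighbourDegreeSum H i + degree H i ≡ n * degree H i
  H-neighbour-degrees i = begin
    nbrSum H i (degree Hᶜ) + nbrSum H i (degree H) + nbrSum H i (λ _ → 1)
      ≡⟨ cong (_+ nbrSum H i (λ _ → 1)) (sym (nbrSum-+ H i (degree Hᶜ) (degree H))) ⟩
    nbrSum H i (λ j → degree Hᶜ j + degree H j) + nbrSum H i (λ _ → 1)
      ≡⟨ sym (nbrSum-+ H i (λ j → degree Hᶜ j + degree H j) (λ _ → 1)) ⟩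
    nbrSum H i (λ j → degree Hᶜ j + degree H j + 1)
      ≡⟨ nbrSum-cong H i complement-degree ⟩
    nbrSum H i (λ _ → n)
      ≡⟨ nbrSum-const H i n ⟩
    n * degree H i ∎
    where open ≡-Reasoning

  complement-degree-sum : ∑ (degree Hᶜ) + ∑ (degree H) + n ≡ n * n
  complement-degree-sum = begin
    ∑ (degree Hᶜ) + ∑ (degree H) + n              ≡⟨ cong (∑ (degree Hᶜ) + ∑ (degree H) +_) (sym (trans (∑-const {n} 1) (*-identityʳ n))) ⟩
    ∑ (degree Hᶜ) + ∑ (degree H) + ∑ {n} (λ _ → 1) ≡⟨ sym (∑-+₃ (degree Hᶜ) (degree H) (λ _ → 1)) ⟩
    ∑ (λ j → degree Hᶜ j + degree H j + 1)         ≡⟨ ∑-cong complement-degree ⟩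
    ∑ {n} (λ _ → n)                                ≡⟨ ∑-const {n} n ⟩
    n * n                                          ∎
    where open ≡-Reasoning

-- For a vertex of degree D in Hᶜ and h in H, write S
-- for its neighbour degree sum in Hᶜ, T = Σ_{j ~_H i} d_j, σ = Σ_{j ~_H i} h_j,
-- and ΣD, Σh for the two degree totals.  The counting identities above
-- together with the balance conditions force S = k·D.
harmonic-arithmetic : ∀ {n k c C D h S T σ ΣD Σh} →
  D + h + 1 ≡ n → S + T + D ≡ ΣD → T + σ + h ≡ n * h → ΣD + Σh + n ≡ n * n →
  σ + h ≡ c * h + C → Σh + c ≡ C + c * n → k + suc c ≡ n → S ≡ k * D
harmonic-arithmetic {k = k} {c} {C} {D} {h} {S} {T} {σ} {Σh = Σh}
                    refl refl T-eq total-eq σ-eq Σh-eq k-eq =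
  +-cancelʳ-≡ Y S (k * D) (trans S+Y (sym kD+Y))
  where
  open ≡-Reasoning
  n = D + h + 1
  Y = n * h + C + c * n + D + n

  regroup₁ : ∀ S nh C cn D n → S + (nh + C + cn + D + n) ≡ S + nh + (C + cn) + D + n
  regroup₁ = solve-∀
  regroup₂ : ∀ S T σ h Σh c D n → S + (T + σ + h) + (Σh + c) + D + n ≡ (S + T + D + Σh + n) + (σ + h) + c
  regroup₂ = solve-∀
  expand : ∀ D h c C → (D + h) * D + ((D + h + 1) * h + C + c * (D + h + 1) + D + (D + h + 1))
                       ≡ (D + h + 1) * (D + h + 1) + (c * h + C) + c + c * D
  expand = solve-∀

  S+Y : S + Y ≡ n * n + (c * h + C) + c
  S+Y = begin
    S + Y                              ≡⟨ regroup₁ S (n * h) C (c * n) D n ⟩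
    S + n * h + (C + c * n) + D + n    ≡⟨ cong₂ (λ a b → S + a + b + D + n) (sym T-eq) (sym Σh-eq) ⟩
    S + (T + σ + h) + (Σh + c) + D + n ≡⟨ regroup₂ S T σ h Σh c D n ⟩
    (S + T + D + Σh + n) + (σ + h) + c ≡⟨ cong₂ (λ a b → a + b + c) total-eq σ-eq ⟩
    n * n + (c * h + C) + c            ∎

  -- k + c = D + h, from the two expressions for n.
  k+c : k + c ≡ D + h
  k+c = suc-injective (trans (sym (+-suc k c)) (trans k-eq (+-comm (D + h) 1)))

  kD+Y : k * D + Y ≡ n * n + (c * h + C) + c
  kD+Y = +-cancelʳ-≡ (c * D) _ _ (begin
    k * D + Y + c * D     ≡⟨ cong (_+ c * D) (+-comm (k * D) Y) ⟩
    Y + k * D + c * D     ≡⟨ +-assoc Y (k * D) (c * D) ⟩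
    Y + (k * D + c * D)   ≡⟨ cong (Y +_) (sym (*-distribʳ-+ D k c)) ⟩
    Y + (k + c) * D       ≡⟨ cong (λ x → Y + x * D) k+c ⟩
    Y + (D + h) * D       ≡⟨ +-comm Y _ ⟩
    (D + h) * D + Y       ≡⟨ expand D h c C ⟩
    n * n + (c * h + C) + c + c * D ∎)

multiple-quotient : ∀ {s} k d .{{_ : NonZero d}} → s ≡ k * d → (⁺ s) ÷ d ≡ (⁺ k) ÷ 1
multiple-quotient k (suc d) refl = fromℚᵘ-cong {mkℚᵘ (⁺ (k * suc d)) d} {mkℚᵘ (⁺ k) 0}
  (*≡* (trans (ℤ.*-identityʳ (⁺ (k * suc d))) (ℤ.pos-* k (suc d))))

-- The
-- sparseness bound h_i + 2 ≤ n makes every complement degree positive, and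
-- the irregular vertex prevents the complement from being regular.
record Balanced (c C : ℕ) {n} (H : Graph n) : Set where
  field
    local     : ∀ i → neighbourDegreeSum H i + degree H i ≡ c * degree H i + C
    total     : ∑ (degree H) + c ≡ C + c * n
    sparse    : ∀ i → suc (degree H i) < n
    witness   : Fin n
    irregular : degree H witness ≢ c
open Balanced

balanced⇒pseudoRegular : ∀ {c C n} {H : Graph n} → Balanced c C H → ∀ k → k + suc c ≡ n →
                         PseudoRegular (complement H) k
balanced⇒pseudoRegular {c} {C} {n} {H} bal k k-eq = (positive , harmonic) , irregular′
  where
  Hᶜ = complement H

  positive : NoIsolated Hᶜ
  positive i = ≢-nonZero λ dᵢ≡0 → <-irrefl (full dᵢ≡0) (sparse bal i)
    where
    full : degree Hᶜ i ≡ 0 → suc (degree H i) ≡ n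
    full dᵢ≡0 = trans (+-comm 1 (degree H i))
                      (trans (cong (λ d → d + degree H i + 1) (sym dᵢ≡0)) (complement-degree H i))

  harmonic : ∀ i → avg2deg Hᶜ i {{positive i}} ≡ (⁺ k) ÷ 1
  harmonic i = multiple-quotient k (degree Hᶜ i) {{positive i}}
    (harmonic-arithmetic (complement-degree H i) (complement-partition H i (degree Hᶜ))
                         (H-neighbour-degrees H i) (complement-degree-sum H)
                         (local bal i) (total bal) k-eq)

  -- A k-regular complement would force h = n - 1 - k = c at every vertex.
  irregular′ : ¬ Regular Hᶜ k
  irregular′ regular = irregular bal (+-cancelˡ-≡ k _ _ (suc-injective (begin
    suc (k + degree H w)    ≡⟨ cong (λ d → suc (d + degree H w)) (sym (regular w)) ⟩
    suc (degree Hᶜ w + degree H w) ≡⟨ +-comm 1 _ ⟩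
    degree Hᶜ w + degree H w + 1   ≡⟨ complement-degree H w ⟩
    n                              ≡⟨ sym k-eq ⟩
    k + suc c                      ≡⟨ +-suc k c ⟩
    suc (k + c)                    ∎)))
    where
    open ≡-Reasoning
    w = witness bal

module _ {a b : ℕ} (H₁ : Graph a) (H₂ : Graph b) where

  private
    adj⊎ : Fin a ⊎ Fin b → Fin a ⊎ Fin b → Bool
    adj⊎ (inj₁ x) (inj₁ y) = adj H₁ x y
    adj⊎ (inj₂ x) (inj₂ y) = adj H₂ x y
    adj⊎ (inj₁ x) (inj₂ y) = false
    adj⊎ (inj₂ x) (inj₁ y) = false

    adj⊎-sym : ∀ s t → adj⊎ s t ≡ adj⊎ t s
    adj⊎-sym (inj₁ x) (inj₁ y) = Graph.sym H₁ x y
    adj⊎-sym (inj₂ x) (inj₂ y) = Graph.sym H₂ x y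
    adj⊎-sym (inj₁ x) (inj₂ y) = refl
    adj⊎-sym (inj₂ x) (inj₁ y) = refl

    adj⊎-irrefl : ∀ s → adj⊎ s s ≡ false
    adj⊎-irrefl (inj₁ x) = irrefl H₁ x
    adj⊎-irrefl (inj₂ x) = irrefl H₂ x

  _⊕_ : Graph (a + b)
  _⊕_ = record
    { adj    = λ i j → adj⊎ (splitAt a i) (splitAt a j)
    ; sym    = λ i j → adj⊎-sym (splitAt a i) (splitAt a j)
    ; irrefl = λ i → adj⊎-irrefl (splitAt a i)
    }

  ⊕-elim : (P : Fin (a + b) → Set) → (∀ x → P (x ↑ˡ b)) → (∀ y → P (a ↑ʳ y)) → ∀ i → P i
  ⊕-elim P left right i = subst P (join-splitAt a b i) (cases (splitAt a i))
    where
    cases : ∀ s → P (join a b s)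
    cases (inj₁ x) = left x
    cases (inj₂ y) = right y

  private
    vanish : ∀ {m} (g : Fin m → Bool) (f : Fin m → ℕ) → (∀ y → g y ≡ false) →
             ∑ (λ y → if g y then f y else 0) ≡ 0
    vanish {m} g f none = trans (∑-cong (λ y → cong (if_then f y else 0) (none y))) (∑-zero {m})

  nbrSum-⊕ˡ : ∀ x (f : Fin (a + b) → ℕ) → nbrSum _⊕_ (x ↑ˡ b) f ≡ nbrSum H₁ x (λ y → f (y ↑ˡ b))
  nbrSum-⊕ˡ x f = begin
    nbrSum _⊕_ (x ↑ˡ b) f
      ≡⟨ ∑-split a _ ⟩
    ∑ (λ y → if adj _⊕_ (x ↑ˡ b) (y ↑ˡ b) then f (y ↑ˡ b) else 0) + ∑ (λ y → if adj _⊕_ (x ↑ˡ b) (a ↑ʳ y) then f (a ↑ʳ y) else 0)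
      ≡⟨ cong₂ _+_ (∑-cong (λ y → cong (if_then f (y ↑ˡ b) else 0) (inner y))) (vanish _ _ outer) ⟩
    nbrSum H₁ x (λ y → f (y ↑ˡ b)) + 0
      ≡⟨ +-identityʳ _ ⟩
    nbrSum H₁ x (λ y → f (y ↑ˡ b)) ∎
    where
    open ≡-Reasoning
    inner : ∀ y → adj _⊕_ (x ↑ˡ b) (y ↑ˡ b) ≡ adj H₁ x y
    inner y rewrite splitAt-↑ˡ a x b | splitAt-↑ˡ a y b = refl
    outer : ∀ y → adj _⊕_ (x ↑ˡ b) (a ↑ʳ y) ≡ false
    outer y rewrite splitAt-↑ˡ a x b | splitAt-↑ʳ a b y = refl

  nbrSum-⊕ʳ : ∀ y (f : Fin (a + b) → ℕ) → nbrSum _⊕_ (a ↑ʳ y) f ≡ nbrSum H₂ y (λ z → f (a ↑ʳ z))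
  nbrSum-⊕ʳ y f = begin
    nbrSum _⊕_ (a ↑ʳ y) f
      ≡⟨ ∑-split a _ ⟩
    ∑ (λ x → if adj _⊕_ (a ↑ʳ y) (x ↑ˡ b) then f (x ↑ˡ b) else 0) + ∑ (λ z → if adj _⊕_ (a ↑ʳ y) (a ↑ʳ z) then f (a ↑ʳ z) else 0)
      ≡⟨ cong₂ _+_ (vanish _ _ outer) (∑-cong (λ z → cong (if_then f (a ↑ʳ z) else 0) (inner z))) ⟩
    0 + nbrSum H₂ y (λ z → f (a ↑ʳ z)) ∎
    where
    open ≡-Reasoning
    inner : ∀ z → adj _⊕_ (a ↑ʳ y) (a ↑ʳ z) ≡ adj H₂ y z
    inner z rewrite splitAt-↑ʳ a b y | splitAt-↑ʳ a b z = refl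
    outer : ∀ x → adj _⊕_ (a ↑ʳ y) (x ↑ˡ b) ≡ false
    outer x rewrite splitAt-↑ʳ a b y | splitAt-↑ˡ a x b = refl

  degree-⊕ˡ : ∀ x → degree _⊕_ (x ↑ˡ b) ≡ degree H₁ x
  degree-⊕ˡ x = nbrSum-⊕ˡ x (λ _ → 1)

  degree-⊕ʳ : ∀ y → degree _⊕_ (a ↑ʳ y) ≡ degree H₂ y
  degree-⊕ʳ y = nbrSum-⊕ʳ y (λ _ → 1)

  neighbourDegreeSum-⊕ˡ : ∀ x → neighbourDegreeSum _⊕_ (x ↑ˡ b) ≡ neighbourDegreeSum H₁ x
  neighbourDegreeSum-⊕ˡ x = trans (nbrSum-⊕ˡ x (degree _⊕_)) (nbrSum-cong H₁ x degree-⊕ˡ)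

  neighbourDegreeSum-⊕ʳ : ∀ y → neighbourDegreeSum _⊕_ (a ↑ʳ y) ≡ neighbourDegreeSum H₂ y
  neighbourDegreeSum-⊕ʳ y = trans (nbrSum-⊕ʳ y (degree _⊕_)) (nbrSum-cong H₂ y degree-⊕ʳ)

  degreeSum-⊕ : ∑ (degree _⊕_) ≡ ∑ (degree H₁) + ∑ (degree H₂)
  degreeSum-⊕ = trans (∑-split a (degree _⊕_)) (cong₂ _+_ (∑-cong degree-⊕ˡ) (∑-cong degree-⊕ʳ))

record Block (c C : ℕ) {n} (H : Graph n) : Set where
  field
    local  : ∀ i → neighbourDegreeSum H i + degree H i ≡ c * degree H i + C
    total  : ∑ (degree H) ≡ c * n
    sparse : ∀ i → suc (degree H i) < n

balanced-⊕ : ∀ {c C a b} {H₁ : Graph a} {H₂ : Graph b} → Balanced c C H₁ → Block c C H₂ →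
             Balanced c C (H₁ ⊕ H₂)
balanced-⊕ {c} {C} {a} {b} {H₁} {H₂} bal blk = record
  { local     = ⊕-elim H₁ H₂ Local
      (λ x → subst₂ LocalAt (sym (neighbourDegreeSum-⊕ˡ H₁ H₂ x)) (sym (degree-⊕ˡ H₁ H₂ x)) (local bal x))
      (λ y → subst₂ LocalAt (sym (neighbourDegreeSum-⊕ʳ H₁ H₂ y)) (sym (degree-⊕ʳ H₁ H₂ y)) (Block.local blk y))
  ; total     = begin
      ∑ (degree (H₁ ⊕ H₂)) + c             ≡⟨ cong (_+ c) (degreeSum-⊕ H₁ H₂) ⟩
      ∑ (degree H₁) + ∑ (degree H₂) + c    ≡⟨ +-assoc (∑ (degree H₁)) _ c ⟩
      ∑ (degree H₁) + (∑ (degree H₂) + c)  ≡⟨ cong (∑ (degree H₁) +_) (+-comm (∑ (degree H₂)) c) ⟩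
      ∑ (degree H₁) + (c + ∑ (degree H₂))  ≡⟨ sym (+-assoc (∑ (degree H₁)) c _) ⟩
      ∑ (degree H₁) + c + ∑ (degree H₂)    ≡⟨ cong₂ _+_ (total bal) (Block.total blk) ⟩
      C + c * a + c * b                    ≡⟨ +-assoc C (c * a) (c * b) ⟩
      C + (c * a + c * b)                  ≡⟨ cong (C +_) (sym (*-distribˡ-+ c a b)) ⟩
      C + c * (a + b)                      ∎
  ; sparse    = ⊕-elim H₁ H₂ Sparse
      (λ x → subst SparseAt (sym (degree-⊕ˡ H₁ H₂ x)) (<-≤-trans (sparse bal x) (m≤m+n a b)))
      (λ y → subst SparseAt (sym (degree-⊕ʳ H₁ H₂ y)) (<-≤-trans (Block.sparse blk y) (m≤n+m b a)))
  ; witness   = witness bal ↑ˡ b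
  ; irregular = λ e → irregular bal (trans (sym (degree-⊕ˡ H₁ H₂ (witness bal))) e)
  }
  where
  open ≡-Reasoning
  LocalAt : ℕ → ℕ → Set
  LocalAt s h = s + h ≡ c * h + C
  Local : Fin (a + b) → Set
  Local i = LocalAt (neighbourDegreeSum (H₁ ⊕ H₂) i) (degree (H₁ ⊕ H₂) i)
  SparseAt : ℕ → Set
  SparseAt h = suc h < a + b
  Sparse : Fin (a + b) → Set
  Sparse i = SparseAt (degree (H₁ ⊕ H₂) i)

listAdj : ∀ {n} → Vec (List ℕ) n → Fin n → Fin n → Bool
listAdj nbs i j = any (toℕ j ≡ᵇ_) (lookup nbs i)

fromNeighbours : ∀ {n} (nbs : Vec (List ℕ) n) →
  {True (all? λ i → all? λ j → listAdj nbs i j Bool.≟ listAdj nbs j i)} →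
  {True (all? λ i → listAdj nbs i i Bool.≟ false)} → Graph n
fromNeighbours nbs {symmetric} {loopless} = record
  { adj = listAdj nbs ; sym = toWitness symmetric ; irrefl = toWitness loopless }

balancedByEvaluation : ∀ c C {n} (H : Graph n) →
  {True (all? λ i → neighbourDegreeSum H i + degree H i ℕ.≟ c * degree H i + C)} →
  {True (∑ (degree H) + c ℕ.≟ C + c * n)} →
  {True (all? λ i → suc (degree H i) ℕ.<? n)} →
  (w : Fin n) → {False (degree H w ℕ.≟ c)} → Balanced c C H
balancedByEvaluation c C H {l} {t} {s} w {irr} = record
  { local = toWitness l ; total = toWitness t ; sparse = toWitness s
  ; witness = w ; irregular = toWitnessFalse irr }

blockByEvaluation : ∀ c C {n} (H : Graph n) →
  {True (all? λ i → neighbourDegreeSum H i + degree H i ℕ.≟ c * degree H i + C)} →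
  {True (∑ (degree H) ℕ.≟ c * n)} →
  {True (all? λ i → suc (degree H i) ℕ.<? n)} → Block c C H
blockByEvaluation c C H {l} {t} {s} = record
  { local = toWitness l ; total = toWitness t ; sparse = toWitness s }

BalancedGraph : ℕ → ℕ → ℕ → Set
BalancedGraph c C n = Σ (Graph n) (Balanced c C)

odd₇ : BalancedGraph 3 4 7
odd₇ = H , balancedByEvaluation 3 4 H (# 0)
  where
  H = fromNeighbours
    ( (3 ∷ 4 ∷ 5 ∷ 6 ∷ []) ∷ (3 ∷ 5 ∷ 6 ∷ []) ∷ (3 ∷ 5 ∷ 6 ∷ []) ∷ (0 ∷ 1 ∷ 2 ∷ 4 ∷ []) ∷
      (0 ∷ 3 ∷ []) ∷ (0 ∷ 1 ∷ 2 ∷ []) ∷ (0 ∷ 1 ∷ 2 ∷ []) ∷ [])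

odd₉ : BalancedGraph 3 4 9
odd₉ = H , balancedByEvaluation 3 4 H (# 0)
  where
  H = fromNeighbours
    ( (1 ∷ 2 ∷ 3 ∷ 4 ∷ []) ∷ (0 ∷ 4 ∷ 7 ∷ 8 ∷ []) ∷ (0 ∷ 3 ∷ 5 ∷ 6 ∷ []) ∷ (0 ∷ 2 ∷ []) ∷
      (0 ∷ 1 ∷ []) ∷ (2 ∷ 6 ∷ 8 ∷ []) ∷ (2 ∷ 5 ∷ 7 ∷ []) ∷ (1 ∷ 6 ∷ 8 ∷ []) ∷
      (1 ∷ 5 ∷ 7 ∷ []) ∷ [])

odd₁₁ : BalancedGraph 3 4 11
odd₁₁ = H , balancedByEvaluation 3 4 H (# 0)
  where
  H = fromNeighbours
    ( (1 ∷ 2 ∷ 3 ∷ 4 ∷ []) ∷ (0 ∷ 3 ∷ 4 ∷ []) ∷ (0 ∷ 3 ∷ 4 ∷ []) ∷ (0 ∷ 1 ∷ 2 ∷ []) ∷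
      (0 ∷ 1 ∷ 2 ∷ []) ∷ (6 ∷ 7 ∷ 9 ∷ 10 ∷ []) ∷ (5 ∷ 7 ∷ 8 ∷ 10 ∷ []) ∷ (5 ∷ 6 ∷ 8 ∷ 9 ∷ []) ∷
      (6 ∷ 7 ∷ []) ∷ (5 ∷ 7 ∷ []) ∷ (5 ∷ 6 ∷ []) ∷ [])

oddBlock : Σ (Graph 6) (Block 3 4)
oddBlock = H , blockByEvaluation 3 4 H
  where
  H = fromNeighbours
    ( (1 ∷ 2 ∷ 4 ∷ 5 ∷ []) ∷ (0 ∷ 2 ∷ 3 ∷ 5 ∷ []) ∷ (0 ∷ 1 ∷ 3 ∷ 4 ∷ []) ∷
      (1 ∷ 2 ∷ []) ∷ (0 ∷ 2 ∷ []) ∷ (0 ∷ 1 ∷ []) ∷ [])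

even₇ : BalancedGraph 4 6 7
even₇ = H , balancedByEvaluation 4 6 H (# 0)
  where
  H = fromNeighbours
    ( (1 ∷ 2 ∷ 4 ∷ 5 ∷ 6 ∷ []) ∷ (0 ∷ 2 ∷ 3 ∷ 5 ∷ 6 ∷ []) ∷ (0 ∷ 1 ∷ 3 ∷ 4 ∷ 6 ∷ []) ∷
      (1 ∷ 2 ∷ 4 ∷ 5 ∷ []) ∷ (0 ∷ 2 ∷ 3 ∷ 5 ∷ []) ∷ (0 ∷ 1 ∷ 3 ∷ 4 ∷ []) ∷ (0 ∷ 1 ∷ 2 ∷ []) ∷ [])

even₉ : BalancedGraph 4 6 9
even₉ = H , balancedByEvaluation 4 6 H (# 0)
  where
  H = fromNeighbours
    ( (3 ∷ 4 ∷ 5 ∷ 6 ∷ 7 ∷ 8 ∷ []) ∷ (2 ∷ 5 ∷ 7 ∷ 8 ∷ []) ∷ (1 ∷ 6 ∷ 7 ∷ 8 ∷ []) ∷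
      (0 ∷ 5 ∷ 7 ∷ []) ∷ (0 ∷ 6 ∷ 8 ∷ []) ∷ (0 ∷ 1 ∷ 3 ∷ 7 ∷ []) ∷ (0 ∷ 2 ∷ 4 ∷ 8 ∷ []) ∷
      (0 ∷ 1 ∷ 2 ∷ 3 ∷ 5 ∷ []) ∷ (0 ∷ 1 ∷ 2 ∷ 4 ∷ 6 ∷ []) ∷ [])

even₁₁ : BalancedGraph 4 6 11
even₁₁ = H , balancedByEvaluation 4 6 H (# 0)
  where
  H = fromNeighbours
    ( (1 ∷ 2 ∷ []) ∷ (0 ∷ 2 ∷ 3 ∷ 4 ∷ 5 ∷ 6 ∷ []) ∷ (0 ∷ 1 ∷ 7 ∷ 8 ∷ 9 ∷ 10 ∷ []) ∷
      (1 ∷ 4 ∷ 7 ∷ 10 ∷ []) ∷ (1 ∷ 3 ∷ 5 ∷ 8 ∷ []) ∷ (1 ∷ 4 ∷ 6 ∷ 9 ∷ []) ∷ (1 ∷ 5 ∷ 7 ∷ 10 ∷ []) ∷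
      (2 ∷ 3 ∷ 6 ∷ 8 ∷ []) ∷ (2 ∷ 4 ∷ 7 ∷ 9 ∷ []) ∷ (2 ∷ 5 ∷ 8 ∷ 10 ∷ []) ∷ (2 ∷ 3 ∷ 6 ∷ 9 ∷ []) ∷ [])

even₁₃ : BalancedGraph 4 6 13
even₁₃ = H , balancedByEvaluation 4 6 H (# 0)
  where
  H = fromNeighbours
    ( (1 ∷ 2 ∷ 3 ∷ 4 ∷ 5 ∷ 6 ∷ []) ∷ (0 ∷ 3 ∷ 4 ∷ 7 ∷ 8 ∷ 9 ∷ []) ∷ (0 ∷ 5 ∷ 6 ∷ 10 ∷ 11 ∷ 12 ∷ []) ∷
      (0 ∷ 1 ∷ 5 ∷ []) ∷ (0 ∷ 1 ∷ 6 ∷ []) ∷ (0 ∷ 2 ∷ 3 ∷ []) ∷ (0 ∷ 2 ∷ 4 ∷ []) ∷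
      (1 ∷ 8 ∷ 10 ∷ 12 ∷ []) ∷ (1 ∷ 7 ∷ 9 ∷ 11 ∷ []) ∷ (1 ∷ 8 ∷ 10 ∷ 12 ∷ []) ∷
      (2 ∷ 7 ∷ 9 ∷ 11 ∷ []) ∷ (2 ∷ 8 ∷ 10 ∷ 12 ∷ []) ∷ (2 ∷ 7 ∷ 9 ∷ 11 ∷ []) ∷ [])

even₁₅ : BalancedGraph 4 6 15
even₁₅ = H , balancedByEvaluation 4 6 H (# 0)
  where
  H = fromNeighbours
    ( (1 ∷ 2 ∷ 3 ∷ 4 ∷ 5 ∷ []) ∷ (0 ∷ 2 ∷ 3 ∷ 4 ∷ 5 ∷ []) ∷ (0 ∷ 1 ∷ 4 ∷ 5 ∷ []) ∷
      (0 ∷ 1 ∷ 4 ∷ 5 ∷ []) ∷ (0 ∷ 1 ∷ 2 ∷ 3 ∷ []) ∷ (0 ∷ 1 ∷ 2 ∷ 3 ∷ []) ∷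
      (7 ∷ 8 ∷ 9 ∷ 10 ∷ 11 ∷ 12 ∷ []) ∷ (6 ∷ 8 ∷ 9 ∷ 10 ∷ 13 ∷ 14 ∷ []) ∷ (6 ∷ 7 ∷ 11 ∷ 12 ∷ 13 ∷ 14 ∷ []) ∷
      (6 ∷ 7 ∷ 12 ∷ []) ∷ (6 ∷ 7 ∷ 13 ∷ []) ∷ (6 ∷ 8 ∷ 14 ∷ []) ∷ (6 ∷ 8 ∷ 9 ∷ []) ∷
      (7 ∷ 8 ∷ 10 ∷ []) ∷ (7 ∷ 8 ∷ 11 ∷ []) ∷ [])

even₁₇ : BalancedGraph 4 6 17
even₁₇ = H , balancedByEvaluation 4 6 H (# 3)
  where
  H = fromNeighbours
    ( (3 ∷ 7 ∷ 11 ∷ 16 ∷ []) ∷ (11 ∷ 14 ∷ 15 ∷ 16 ∷ []) ∷ (5 ∷ 10 ∷ 12 ∷ 15 ∷ []) ∷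
      (0 ∷ 5 ∷ 8 ∷ 12 ∷ 13 ∷ 16 ∷ []) ∷ (5 ∷ 6 ∷ []) ∷ (2 ∷ 3 ∷ 4 ∷ 6 ∷ 7 ∷ 10 ∷ []) ∷
      (4 ∷ 5 ∷ 8 ∷ 11 ∷ 14 ∷ 15 ∷ []) ∷ (0 ∷ 5 ∷ 11 ∷ []) ∷ (3 ∷ 6 ∷ []) ∷ (11 ∷ 13 ∷ 14 ∷ 15 ∷ []) ∷
      (2 ∷ 5 ∷ 15 ∷ []) ∷ (0 ∷ 1 ∷ 6 ∷ 7 ∷ 9 ∷ []) ∷ (2 ∷ 3 ∷ 13 ∷ 14 ∷ []) ∷ (3 ∷ 9 ∷ 12 ∷ 16 ∷ []) ∷
      (1 ∷ 6 ∷ 9 ∷ 12 ∷ []) ∷ (1 ∷ 2 ∷ 6 ∷ 9 ∷ 10 ∷ []) ∷ (0 ∷ 1 ∷ 3 ∷ 13 ∷ []) ∷ [])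

evenBlock : Σ (Graph 12) (Block 4 6)
evenBlock = H , blockByEvaluation 4 6 H
  where
  H = fromNeighbours
    ( (1 ∷ 3 ∷ 4 ∷ 5 ∷ 6 ∷ 7 ∷ []) ∷ (0 ∷ 2 ∷ 8 ∷ 9 ∷ 10 ∷ 11 ∷ []) ∷ (1 ∷ 3 ∷ 4 ∷ 5 ∷ 6 ∷ 7 ∷ []) ∷
      (0 ∷ 2 ∷ 8 ∷ 9 ∷ 10 ∷ 11 ∷ []) ∷ (0 ∷ 2 ∷ 8 ∷ []) ∷ (0 ∷ 2 ∷ 9 ∷ []) ∷ (0 ∷ 2 ∷ 10 ∷ []) ∷
      (0 ∷ 2 ∷ 11 ∷ []) ∷ (1 ∷ 3 ∷ 4 ∷ []) ∷ (1 ∷ 3 ∷ 5 ∷ []) ∷ (1 ∷ 3 ∷ 6 ∷ []) ∷ (1 ∷ 3 ∷ 7 ∷ []) ∷ [])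

extend : ∀ {c C a b} → BalancedGraph c C a → Σ (Graph b) (Block c C) → BalancedGraph c C (a + b)
extend (H₁ , bal) (H₂ , blk) = H₁ ⊕ H₂ , balanced-⊕ bal blk

oddFamily : ∀ m → BalancedGraph 3 4 (3 + 2 * m + 4)
oddFamily 0 = odd₇
oddFamily 1 = odd₉
oddFamily 2 = odd₁₁
oddFamily (suc (suc (suc m))) = subst (BalancedGraph 3 4) (size m) (extend (oddFamily m) oddBlock)
  where
  size : ∀ m → 3 + 2 * m + 4 + 6 ≡ 3 + 2 * (3 + m) + 4
  size = solve-∀

evenFamily : ∀ m → BalancedGraph 4 6 (4 + 2 * m + 5)
evenFamily 0 = even₉
evenFamily 1 = even₁₁
evenFamily 2 = even₁₃
evenFamily 3 = even₁₅
evenFamily 4 = even₁₇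
evenFamily 5 = extend even₇ evenBlock
evenFamily (suc (suc (suc (suc (suc (suc m)))))) =
  subst (BalancedGraph 4 6) (size m) (extend (evenFamily m) evenBlock)
  where
  size : ∀ m → 4 + 2 * m + 5 + 12 ≡ 4 + 2 * (6 + m) + 5
  size = solve-∀

odd-form : ∀ k → k % 2 ≡ 1 → 3 ≤ k → Σ ℕ λ m → k ≡ 3 + 2 * m
odd-form k k-odd 3≤k = shape (k / 2) (trans (m≡m%n+[m/n]*n k 2) (cong (_+ (k / 2) * 2) k-odd))
  where
  shape : ∀ q → k ≡ 1 + q * 2 → Σ ℕ λ m → k ≡ 3 + 2 * m
  shape zero    k≡1  = contradiction (subst (3 ≤_) k≡1 3≤k) λ { (s≤s ()) }
  shape (suc m) k≡2q+1 = m , trans k≡2q+1 (cong (3 +_) (*-comm m 2))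

even-form : ∀ k → k % 2 ≡ 0 → 3 ≤ k → Σ ℕ λ m → k ≡ 4 + 2 * m
even-form k k-even 3≤k = shape (k / 2) (trans (m≡m%n+[m/n]*n k 2) (cong (_+ (k / 2) * 2) k-even))
  where
  shape : ∀ q → k ≡ q * 2 → Σ ℕ λ m → k ≡ 4 + 2 * m
  shape 0 k≡0 = contradiction (subst (3 ≤_) k≡0 3≤k) λ ()
  shape 1 k≡2 = contradiction (subst (3 ≤_) k≡2 3≤k) λ { (s≤s (s≤s ())) }
  shape (suc (suc m)) k≡2q = m , trans k≡2q (cong (4 +_) (*-comm m 2))

pseudoRegularGraph : ∀ {c C} k → BalancedGraph c C (k + suc c) →
                     Σ ℕ λ n → Σ (Graph n) λ G → PseudoRegular G k × n ≤ k + suc c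
pseudoRegularGraph {c} k (H , bal) = k + suc c , complement H , balanced⇒pseudoRegular bal k refl , ≤-refl

proposition5p5 : (k : ℕ) → 3 ≤ k →
    (k % 2 ≡ 1 → Σ ℕ λ n → Σ (Graph n) λ G → PseudoRegular G k × n ≤ k + 4) ×
    (k % 2 ≡ 0 → Σ ℕ λ n → Σ (Graph n) λ G → PseudoRegular G k × n ≤ k + 6)
proposition5p5 k 3≤k = odd-case , even-case
  where
  odd-case : k % 2 ≡ 1 → Σ ℕ λ n → Σ (Graph n) λ G → PseudoRegular G k × n ≤ k + 4
  odd-case k-odd with odd-form k k-odd 3≤k
  ... | m , k≡3+2m = pseudoRegularGraph k (subst (BalancedGraph 3 4) (cong (_+ 4) (sym k≡3+2m)) (oddFamily m))

  even-case : k % 2 ≡ 0 → Σ ℕ λ n → Σ (Graph n) λ G → PseudoRegular G k × n ≤ k + 6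
  even-case k-even with even-form k k-even 3≤k
  ... | m , k≡4+2m with pseudoRegularGraph k (subst (BalancedGraph 4 6) (cong (_+ 5) (sym k≡4+2m)) (evenFamily m))
  ...   | n , G , pseudo , n≤k+5 = n , G , pseudo , ≤-trans n≤k+5 (+-monoʳ-≤ k (n≤1+n 5))
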